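{- Let $d\geq 2$, let $i,j\geq 0$ with $j\leq i$, $I=[i,i+d-1]$ and $J=[j,j+d-2]$. If $1\leq r\leq d$, then \[ b^{I\setminus\{i+r-1\}}_J=\pi^{I\setminus\{i+r-1\}}_J\; b_{d-1,\,r-1}. \]
   Context: For integers $p,q\geq 0$, $b_{p,q}=\binom{p}{q}$, with $b_{p,q}=0$ if $q>p$. For $k\leq l$, $[k,l]=\{k,\ldots,l\}$. For finite sets $I=\{i_1<\cdots<i_m\}$, $J=\{j_1<\cdots<j_m\}$ of non-negative integers, $b^I_J$ is the determinant of the $m\times m$ matrix with $(r,s)$ entry $b_{i_r,j_s}$, and $\pi^I_J=\frac{b_{i_1,j_1}\cdots b_{i_m,j_1}}{b_{j_1,j_1}\cdots b_{j_m,j_1}}$ (a rational number). -}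

module Defs where

open import Data.Nat using (ℕ; zero; suc; _+_)
open import Data.Nat.Combinatorics using (_C_)
open import Data.Integer as ℤ using (ℤ)
open import Data.Rational as ℚ using (ℚ)
open import Data.Fin using (Fin; zero; suc; punchIn; toℕ)
open import Data.Vec using (Vec; []; _∷_; lookup; head)

-- b_{p,q} = binomial(p, q), equal to 0 when q > p (stdlib's _C_ does this).
b : ℕ → ℕ → ℕ
b p q = p C q

interval : ℕ → (n : ℕ) → Vec ℕ n
interval k zero    = []
interval k (suc n) = k ∷ interval (suc k) n

sumℤ : ∀ {m} → (Fin m → ℤ) → ℤ
sumℤ {zero}  f = ℤ.0ℤ
sumℤ {suc m} f = f zero ℤ.+ sumℤ (λ k → f (suc k))

sign : ℕ → ℤ
sign zero          = ℤ.1ℤ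
sign (suc zero)    = ℤ.-1ℤ
sign (suc (suc n)) = sign n

det : ∀ {m} → (Fin m → Fin m → ℤ) → ℤ
det {zero}  M = ℤ.1ℤ
det {suc m} M =
  sumℤ (λ k → sign (toℕ k) ℤ.* (M zero k ℤ.* det (λ a c → M (suc a) (punchIn k c))))

-- b^I_J for I = {i_1 < ... < i_m}, J = {j_1 < ... < j_m} given as increasing vectors
bIJ : ∀ {m} → Vec ℕ m → Vec ℕ m → ℤ
bIJ I J = det (λ r s → ℤ.+ (b (lookup I r) (lookup J s)))

prodℕ : ∀ {m} → Vec ℕ m → ℕ
prodℕ []       = 1
prodℕ (x ∷ xs) = x Data.Nat.* prodℕ xs

mapV : ∀ {m} → (ℕ → ℕ) → Vec ℕ m → Vec ℕ m
mapV f []       = []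
mapV f (x ∷ xs) = f x ∷ mapV f xs

-- n / d as a rational (total: returns 0 when d = 0, which never happens below)
divℕ : ℕ → ℕ → ℚ
divℕ n zero    = ℚ.0ℚ
divℕ n (suc d) = ℤ.+ n ℚ./ suc d

πIJ : ∀ {m} → Vec ℕ m → Vec ℕ m → ℚ
πIJ {zero}  I J = ℚ.1ℚ
πIJ {suc m} I J =
  divℕ (prodℕ (mapV (λ x → b x (head J)) I)) (prodℕ (mapV (λ x → b x (head J)) J))

-- position r-1 (0-based) of the r-th element, for 1 ≤ r ≤ n+1
open import Data.Nat using (_≤_; _∸_)
open import Data.Nat.Properties using (≤-trans; m∸n≤m)
open import Data.Fin using (fromℕ<)

pos : (n r : ℕ) → 1 ≤ r → r ≤ suc n → Fin (suc n)
pos n r 1≤r r≤ = fromℕ< {r ∸ 1} r≤′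
  where
  open Data.Nat.Properties
  r≤′ : suc (r ∸ 1) ≤ suc n
  r≤′ = Data.Nat.Properties.≤-trans (Data.Nat.Properties.≤-reflexive (m+[n∸m]≡n 1≤r)) r≤

{-# OPTIONS --safe #-}
-- Writing x_t for the rows of I∖{i+r-1}, the identity C(x, j+s)·C(j+s, j) = C(x, j)·C(x−j, s) pulls
-- C(x_t, j) out of row t and C(j+s, j) out of column s, so b^{I∖{i+r-1}}_J = π^{I∖{i+r-1}}_J·det[C(x_t − j, s)].
-- Pascal's rule, applied as column operations from left to right, gives det[C(y_t + 1, s)] = det[C(y_t, s)]
-- for any rows y, so the rows x_t − j may be shifted down to [0, d−1] ∖ {r−1}.  There the first row is
-- (1, 0, …, 0) when r > 1, and the absorption identity (s+1)·C(y+1, s+1) = (y+1)·C(y, s) reduces the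
-- remaining minor to the same determinant one size smaller, so it equals C(d−1, r−1) by induction; for
-- r = 1 one further shift reduces to the case r = d.

module Submission where

open import Defs
open import Data.Nat using (ℕ; suc; _≤_; _∸_)
open import Data.Vec using (removeAt)
open import Data.Integer using (+_)
open import Data.Rational using (ℚ; _*_; _/_)
open import Relation.Binary.PropositionalEquality using (_≡_)

open import Data.Nat as ℕ using (zero; _<_; s≤s; _!)
import Data.Nat.Properties as ℕₚ
open import Data.Nat.Combinatorics using (_C_; nCk+nC[k+1]≡[n+1]C[k+1]; nCn≡1; nC1≡n)
open import Data.Integer as ℤ using (ℤ; 0ℤ; 1ℤ)
import Data.Integer.Properties as ℤₚ
import Data.Integer.Tactic.RingSolver as ℤ-Solver
import Data.Nat.Tactic.RingSolver as ℕ-Solver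
import Algebra.Properties.CommutativeSemigroup ℤₚ.+-commutativeSemigroup as ℤ+
import Algebra.Properties.CommutativeSemigroup ℤₚ.*-commutativeSemigroup as ℤ*
import Algebra.Properties.CommutativeSemigroup ℕₚ.*-commutativeSemigroup as ℕ*
open import Algebra.Properties.CommutativeMonoid.Sum ℤₚ.*-1-commutativeMonoid
  using ()
  renaming (sum to prodℤ; sum-cong-≗ to prodℤ-cong; sum-remove to prodℤ-remove; sum-init-last to prodℤ-init-last)
open import Data.Fin using (Fin; zero; suc; punchIn; punchOut; toℕ; fromℕ; fromℕ<; inject₁)
import Data.Fin.Properties as Finₚ
open import Data.Vec using (Vec; []; _∷_; lookup)
import Data.Vec.Properties as Vecₚ
open import Data.Vec.Functional using (updateAt)
open import Data.Vec.Functional.Properties using (updateAt-updates; updateAt-minimal)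
open import Data.Product using (Σ-syntax; _×_; _,_)
open import Data.Rational using (toℚᵘ)
open import Data.Rational.Properties using (toℚᵘ-injective; toℚᵘ-fromℚᵘ; toℚᵘ-homo-*)
open import Data.Rational.Unnormalised as ℚᵘ using (mkℚᵘ; *≡*)
import Data.Rational.Unnormalised.Properties as ℚᵘₚ
open import Data.Empty using (⊥-elim)
open import Function using (_∘_; const)
open import Relation.Binary.PropositionalEquality
  using (refl; sym; trans; cong; cong₂; subst; _≢_; module ≡-Reasoning)
open import Relation.Nullary using (yes; no)

cross-multiplication : ∀ (z : ℤ) p q c → 0 < q → z ℤ.* + q ≡ + p ℤ.* + c → z / 1 ≡ divℕ p q * (+ c / 1)
cross-multiplication z p (suc q) c _ zq≡pc = toℚᵘ-injective (begin
    toℚᵘ (z / 1)                                 ≈⟨ toℚᵘ-fromℚᵘ (mkℚᵘ z 0) ⟩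
    mkℚᵘ z 0                                      ≈⟨ *≡* cross-multiplied ⟩
    mkℚᵘ (+ p) q ℚᵘ.* mkℚᵘ (+ c) 0                ≈⟨ ℚᵘₚ.*-cong (toℚᵘ-fromℚᵘ (mkℚᵘ (+ p) q)) (toℚᵘ-fromℚᵘ (mkℚᵘ (+ c) 0)) ⟨
    toℚᵘ (+ p / suc q) ℚᵘ.* toℚᵘ (+ c / 1)       ≈⟨ toℚᵘ-homo-* (+ p / suc q) (+ c / 1) ⟨
    toℚᵘ (+ p / suc q * (+ c / 1))               ∎)
  where
  open ℚᵘₚ.≃-Reasoning
  cross-multiplied : z ℤ.* + (suc q ℕ.* 1) ≡ (+ p ℤ.* + c) ℤ.* + 1
  cross-multiplied = trans (cong (λ n → z ℤ.* + n) (ℕₚ.*-identityʳ (suc q)))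
                           (trans zq≡pc (sym (ℤₚ.*-identityʳ (+ p ℤ.* + c))))

open ≡-Reasoning

sumℤ-cong : ∀ {m} {f g : Fin m → ℤ} → (∀ k → f k ≡ g k) → sumℤ f ≡ sumℤ g
sumℤ-cong {zero}  f≗g = refl
sumℤ-cong {suc m} f≗g = cong₂ ℤ._+_ (f≗g zero) (sumℤ-cong (f≗g ∘ suc))

sumℤ-zero : ∀ {m} {f : Fin m → ℤ} → (∀ k → f k ≡ 0ℤ) → sumℤ f ≡ 0ℤ
sumℤ-zero {zero}  f≗0 = refl
sumℤ-zero {suc m} f≗0 = cong₂ ℤ._+_ (f≗0 zero) (sumℤ-zero (f≗0 ∘ suc))

sumℤ-distrib-+ : ∀ {m} (f g : Fin m → ℤ) → sumℤ (λ k → f k ℤ.+ g k) ≡ sumℤ f ℤ.+ sumℤ g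
sumℤ-distrib-+ {zero}  f g = refl
sumℤ-distrib-+ {suc m} f g =
  trans (cong (ℤ._+_ (f zero ℤ.+ g zero)) (sumℤ-distrib-+ (f ∘ suc) (g ∘ suc)))
        (ℤ+.interchange (f zero) (g zero) (sumℤ (f ∘ suc)) (sumℤ (g ∘ suc)))

*-distribˡ-sumℤ : ∀ {m} (l : ℤ) (f : Fin m → ℤ) → l ℤ.* sumℤ f ≡ sumℤ (λ k → l ℤ.* f k)
*-distribˡ-sumℤ {zero}  l f = ℤₚ.*-zeroʳ l
*-distribˡ-sumℤ {suc m} l f =
  trans (ℤₚ.*-distribˡ-+ l (f zero) (sumℤ (f ∘ suc))) (cong (ℤ._+_ (l ℤ.* f zero)) (*-distribˡ-sumℤ l (f ∘ suc)))

sumℤ-adjacent-cancel : ∀ {n} (f : Fin (suc (suc n)) → ℤ) (c : Fin (suc n)) →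
  f (inject₁ c) ℤ.+ f (suc c) ≡ 0ℤ → (∀ k → k ≢ inject₁ c → k ≢ suc c → f k ≡ 0ℤ) → sumℤ f ≡ 0ℤ
sumℤ-adjacent-cancel f zero pair others =
  trans (sym (ℤₚ.+-assoc (f zero) (f (suc zero)) _))
        (cong₂ ℤ._+_ pair (sumℤ-zero λ k → others (suc (suc k)) (λ ()) (λ ())))
sumℤ-adjacent-cancel {suc n} f (suc c) pair others =
  cong₂ ℤ._+_ (others zero (λ ()) (λ ()))
    (sumℤ-adjacent-cancel (f ∘ suc) c pair λ k k≢c k≢c+1 →
      others (suc k) (k≢c ∘ Finₚ.suc-injective) (k≢c+1 ∘ Finₚ.suc-injective))

sign-suc : ∀ n → sign (suc n) ≡ ℤ.- sign n
sign-suc zero    = refl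
sign-suc (suc n) = sym (trans (cong ℤ.-_ (sign-suc n)) (ℤₚ.neg-involutive (sign n)))

Matrix : ℕ → Set
Matrix m = Fin m → Fin m → ℤ

minor : ∀ {m} → Matrix (suc m) → Fin (suc m) → Matrix m
minor M k a c = M (suc a) (punchIn k c)

laplaceTerm : ∀ {m} → Matrix (suc m) → Fin (suc m) → ℤ
laplaceTerm M k = sign (toℕ k) ℤ.* (M zero k ℤ.* det (minor M k))

det-cong : ∀ {m} {M N : Matrix m} → (∀ a c → M a c ≡ N a c) → det M ≡ det N
det-cong {zero}  M≗N = refl
det-cong {suc m} M≗N = sumℤ-cong λ k →
  cong₂ (λ x d → sign (toℕ k) ℤ.* (x ℤ.* d)) (M≗N zero k) (det-cong λ a c → M≗N (suc a) (punchIn k c))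

det-scale-rows : ∀ {m} (f : Fin m → ℤ) (M : Matrix m) →
  det (λ a c → f a ℤ.* M a c) ≡ prodℤ f ℤ.* det M
det-scale-rows {zero}  f M = refl
det-scale-rows {suc m} f M = begin
    sumℤ (λ k → sign (toℕ k) ℤ.* ((f zero ℤ.* M zero k) ℤ.* det (λ a c → f (suc a) ℤ.* minor M k a c)))
  ≡⟨ sumℤ-cong (λ k → cong (λ d → sign (toℕ k) ℤ.* ((f zero ℤ.* M zero k) ℤ.* d))
                            (det-scale-rows (f ∘ suc) (minor M k))) ⟩
    sumℤ (λ k → sign (toℕ k) ℤ.* ((f zero ℤ.* M zero k) ℤ.* (prodℤ (f ∘ suc) ℤ.* det (minor M k))))
  ≡⟨ sumℤ-cong (λ k → rearrange (sign (toℕ k)) (f zero) (M zero k) (prodℤ (f ∘ suc)) (det (minor M k))) ⟩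
    sumℤ (λ k → prodℤ f ℤ.* laplaceTerm M k)
  ≡⟨ *-distribˡ-sumℤ (prodℤ f) (laplaceTerm M) ⟨
    prodℤ f ℤ.* det M ∎
  where
  rearrange : ∀ σ u x v d → σ ℤ.* ((u ℤ.* x) ℤ.* (v ℤ.* d)) ≡ (u ℤ.* v) ℤ.* (σ ℤ.* (x ℤ.* d))
  rearrange = ℤ-Solver.solve-∀

det-scale-columns : ∀ {m} (g : Fin m → ℤ) (M : Matrix m) →
  det (λ a c → M a c ℤ.* g c) ≡ prodℤ g ℤ.* det M
det-scale-columns {zero}  g M = refl
det-scale-columns {suc m} g M = begin
    sumℤ (λ k → sign (toℕ k) ℤ.* ((M zero k ℤ.* g k) ℤ.* det (λ a c → minor M k a c ℤ.* g (punchIn k c))))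
  ≡⟨ sumℤ-cong (λ k → cong (λ d → sign (toℕ k) ℤ.* ((M zero k ℤ.* g k) ℤ.* d))
                            (det-scale-columns (g ∘ punchIn k) (minor M k))) ⟩
    sumℤ (λ k → sign (toℕ k) ℤ.* ((M zero k ℤ.* g k) ℤ.* (prodℤ (g ∘ punchIn k) ℤ.* det (minor M k))))
  ≡⟨ sumℤ-cong (λ k → trans (rearrange (sign (toℕ k)) (M zero k) (g k) (prodℤ (g ∘ punchIn k)) (det (minor M k)))
                            (cong (ℤ._* laplaceTerm M k) (sym (prodℤ-remove {i = k} g)))) ⟩
    sumℤ (λ k → prodℤ g ℤ.* laplaceTerm M k)
  ≡⟨ *-distribˡ-sumℤ (prodℤ g) (laplaceTerm M) ⟨
    prodℤ g ℤ.* det M ∎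
  where
  rearrange : ∀ σ x u v d → σ ℤ.* ((x ℤ.* u) ℤ.* (v ℤ.* d)) ≡ (u ℤ.* v) ℤ.* (σ ℤ.* (x ℤ.* d))
  rearrange = ℤ-Solver.solve-∀

det-rescale : ∀ {m} {f g : Fin m → ℤ} {M N : Matrix m} →
  (∀ a c → M a c ℤ.* g c ≡ f a ℤ.* N a c) → prodℤ g ℤ.* det M ≡ prodℤ f ℤ.* det N
det-rescale {f = f} {g} {M} {N} Mg≡fN =
  trans (sym (det-scale-columns g M)) (trans (det-cong Mg≡fN) (det-scale-rows f N))

det-unit-first-row : ∀ {m} (M : Matrix (suc m)) →
  M zero zero ≡ 1ℤ → (∀ c → M zero (suc c) ≡ 0ℤ) → det M ≡ det (minor M zero)
det-unit-first-row M M₀₀≡1 M₀c≡0 = begin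
    laplaceTerm M zero ℤ.+ sumℤ (laplaceTerm M ∘ suc)
  ≡⟨ cong₂ ℤ._+_ leading (sumℤ-zero vanishing) ⟩
    det (minor M zero) ℤ.+ 0ℤ
  ≡⟨ ℤₚ.+-identityʳ _ ⟩
    det (minor M zero) ∎
  where
  leading : laplaceTerm M zero ≡ det (minor M zero)
  leading = trans (ℤₚ.*-identityˡ _)
                  (trans (cong (ℤ._* det (minor M zero)) M₀₀≡1) (ℤₚ.*-identityˡ _))
  vanishing : ∀ k → laplaceTerm M (suc k) ≡ 0ℤ
  vanishing k = trans (cong (λ x → sign (toℕ (suc k)) ℤ.* (x ℤ.* det (minor M (suc k)))) (M₀c≡0 k))
                      (ℤₚ.*-zeroʳ (sign (toℕ (suc k))))

det-additive-column : ∀ {m} (c : Fin m) {L R M : Matrix m} →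
  (∀ a s → s ≢ c → L a s ≡ M a s) → (∀ a s → s ≢ c → R a s ≡ M a s) →
  (∀ a → M a c ≡ L a c ℤ.+ R a c) → det M ≡ det L ℤ.+ det R
det-additive-column {suc m} c {L} {R} {M} L≈M R≈M M≡L+R =
  trans (sumℤ-cong term-additive) (sumℤ-distrib-+ (laplaceTerm L) (laplaceTerm R))
  where
  term-additive : ∀ k → laplaceTerm M k ≡ laplaceTerm L k ℤ.+ laplaceTerm R k
  term-additive k with k Finₚ.≟ c
  ... | yes refl =
    trans (cong (λ x → sign (toℕ k) ℤ.* (x ℤ.* det (minor M k))) (M≡L+R zero))
      (trans (distrib (sign (toℕ k)) (L zero k) (R zero k) (det (minor M k)))
        (cong₂ (λ dL dR → sign (toℕ k) ℤ.* (L zero k ℤ.* dL) ℤ.+ sign (toℕ k) ℤ.* (R zero k ℤ.* dR))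
               (det-cong λ a s → sym (L≈M (suc a) (punchIn k s) (Finₚ.punchInᵢ≢i k s)))
               (det-cong λ a s → sym (R≈M (suc a) (punchIn k s) (Finₚ.punchInᵢ≢i k s)))))
    where
    distrib : ∀ σ x y d → σ ℤ.* ((x ℤ.+ y) ℤ.* d) ≡ σ ℤ.* (x ℤ.* d) ℤ.+ σ ℤ.* (y ℤ.* d)
    distrib = ℤ-Solver.solve-∀
  ... | no k≢c =
    trans (cong₂ (λ x d → sign (toℕ k) ℤ.* (x ℤ.* d)) (sym (L≈M zero k k≢c)) minor-additive)
      (trans (distrib (sign (toℕ k)) (L zero k) (det (minor L k)) (det (minor R k)))
        (cong (λ x → laplaceTerm L k ℤ.+ sign (toℕ k) ℤ.* (x ℤ.* det (minor R k)))
              (trans (L≈M zero k k≢c) (sym (R≈M zero k k≢c)))))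
    where
    c′ : Fin m
    c′ = punchOut k≢c
    ↑c′≡c : punchIn k c′ ≡ c
    ↑c′≡c = Finₚ.punchIn-punchOut k≢c
    ↑s≢c : ∀ s → s ≢ c′ → punchIn k s ≢ c
    ↑s≢c s s≢c′ ↑s≡c = s≢c′ (Finₚ.punchIn-injective k s c′ (trans ↑s≡c (sym ↑c′≡c)))
    minor-additive : det (minor M k) ≡ det (minor L k) ℤ.+ det (minor R k)
    minor-additive = det-additive-column c′
      (λ a s s≢c′ → L≈M (suc a) (punchIn k s) (↑s≢c s s≢c′))
      (λ a s s≢c′ → R≈M (suc a) (punchIn k s) (↑s≢c s s≢c′))
      (λ a → subst (λ s → M (suc a) s ≡ L (suc a) s ℤ.+ R (suc a) s) (sym ↑c′≡c) (M≡L+R (suc a)))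
    distrib : ∀ σ x d e → σ ℤ.* (x ℤ.* (d ℤ.+ e)) ≡ σ ℤ.* (x ℤ.* d) ℤ.+ σ ℤ.* (x ℤ.* e)
    distrib = ℤ-Solver.solve-∀

punchIn-adjacent : ∀ {n} {X : Set} (v : Fin (suc (suc n)) → X) (c : Fin (suc n)) →
  v (inject₁ c) ≡ v (suc c) → ∀ s → v (punchIn (inject₁ c) s) ≡ v (punchIn (suc c) s)
punchIn-adjacent         v zero    v≡ zero    = sym v≡
punchIn-adjacent         v zero    v≡ (suc s) = refl
punchIn-adjacent {suc n} v (suc c) v≡ zero    = refl
punchIn-adjacent {suc n} v (suc c) v≡ (suc s) = punchIn-adjacent (v ∘ suc) c v≡ s

punchIn-adjacent-preimage : ∀ {n} (k : Fin (suc (suc n))) (c : Fin (suc n)) → k ≢ inject₁ c → k ≢ suc c →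
  Σ[ c₁ ∈ Fin n ] punchIn k (inject₁ c₁) ≡ inject₁ c × punchIn k (suc c₁) ≡ suc c
punchIn-adjacent-preimage zero          zero    k≢c _     = ⊥-elim (k≢c refl)
punchIn-adjacent-preimage zero          (suc c) _   _     = c , refl , refl
punchIn-adjacent-preimage (suc zero)    zero    _   k≢c+1 = ⊥-elim (k≢c+1 refl)
punchIn-adjacent-preimage {suc n} (suc (suc k)) zero _ _  = zero , refl , refl
punchIn-adjacent-preimage {suc n} (suc k) (suc c) k≢c k≢c+1
  with punchIn-adjacent-preimage k c (k≢c ∘ cong suc) (k≢c+1 ∘ cong suc)
... | c₁ , ↑c₁≡c , ↑c₁+1≡c+1 = suc c₁ , cong suc ↑c₁≡c , cong suc ↑c₁+1≡c+1

det-adjacent-equal-columns : ∀ {n} (M : Matrix (suc n)) (c : Fin n) →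
  (∀ a → M a (inject₁ c) ≡ M a (suc c)) → det M ≡ 0ℤ
det-adjacent-equal-columns {suc n} M c cols≡ =
  sumℤ-adjacent-cancel (laplaceTerm M) c opposite-terms other-terms-vanish
  where
  y : ℤ
  y = M zero (suc c) ℤ.* det (minor M (suc c))
  σ : ℤ
  σ = sign (toℕ c)
  opposite-terms : laplaceTerm M (inject₁ c) ℤ.+ laplaceTerm M (suc c) ≡ 0ℤ
  opposite-terms = begin
      laplaceTerm M (inject₁ c) ℤ.+ laplaceTerm M (suc c)
    ≡⟨ cong₂ ℤ._+_
         (cong₂ ℤ._*_ (cong sign (Finₚ.toℕ-inject₁ c))
                      (cong₂ ℤ._*_ (cols≡ zero) (det-cong λ a → punchIn-adjacent (M (suc a)) c (cols≡ (suc a)))))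
         (cong (ℤ._* y) (sign-suc (toℕ c))) ⟩
      σ ℤ.* y ℤ.+ ℤ.- σ ℤ.* y
    ≡⟨ cong (ℤ._+_ (σ ℤ.* y)) (ℤₚ.neg-distribˡ-* σ y) ⟨
      σ ℤ.* y ℤ.+ ℤ.- (σ ℤ.* y)
    ≡⟨ ℤₚ.+-inverseʳ (σ ℤ.* y) ⟩
      0ℤ ∎
  other-terms-vanish : ∀ k → k ≢ inject₁ c → k ≢ suc c → laplaceTerm M k ≡ 0ℤ
  other-terms-vanish k k≢c k≢c+1 with punchIn-adjacent-preimage k c k≢c k≢c+1
  ... | c₁ , ↑c₁≡c , ↑c₁+1≡c+1 =
    trans (cong (λ d → sign (toℕ k) ℤ.* (M zero k ℤ.* d))
                (det-adjacent-equal-columns (minor M k) c₁ λ a →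
                  trans (cong (M (suc a)) ↑c₁≡c) (trans (cols≡ (suc a)) (cong (M (suc a)) (sym ↑c₁+1≡c+1)))))
          (trans (cong (sign (toℕ k) ℤ.*_) (ℤₚ.*-zeroʳ (M zero k))) (ℤₚ.*-zeroʳ (sign (toℕ k))))

inject₁≢suc : ∀ {n} (c : Fin n) → inject₁ c ≢ suc c
inject₁≢suc (suc c) ↑c≡c+1 = inject₁≢suc c (Finₚ.suc-injective ↑c≡c+1)

det-add-previous-column : ∀ {n} (c : Fin (suc n)) {M N : Matrix (suc (suc n))} →
  (∀ a s → s ≢ suc c → M a s ≡ N a s) → (∀ a → N a (suc c) ≡ M a (suc c) ℤ.+ M a (inject₁ c)) →
  det N ≡ det M
det-add-previous-column {n} c {M} {N} M≈N N≡M+M = begin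
    det N
  ≡⟨ det-additive-column (suc c) M≈N R≈N
       (λ a → trans (N≡M+M a) (cong (ℤ._+_ (M a (suc c))) (sym (updateAt-updates (suc c) (M a))))) ⟩
    det M ℤ.+ det R
  ≡⟨ cong (ℤ._+_ (det M)) (det-adjacent-equal-columns R c R-cols≡) ⟩
    det M ℤ.+ 0ℤ
  ≡⟨ ℤₚ.+-identityʳ (det M) ⟩
    det M ∎
  where
  R : Matrix (suc (suc n))
  R a = updateAt (M a) (suc c) (const (M a (inject₁ c)))
  R≈N : ∀ a s → s ≢ suc c → R a s ≡ N a s
  R≈N a s s≢c+1 = trans (updateAt-minimal s (suc c) (M a) s≢c+1) (M≈N a s s≢c+1)
  R-cols≡ : ∀ a → R a (inject₁ c) ≡ R a (suc c)
  R-cols≡ a = trans (updateAt-minimal (inject₁ c) (suc c) (M a) (inject₁≢suc c))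
                    (sym (updateAt-updates (suc c) (M a)))

pascal : ∀ n k → suc n C suc k ≡ n C k ℕ.+ n C suc k
pascal n k = sym (nCk+nC[k+1]≡[n+1]C[k+1] n k)

0<nCk : ∀ {n k} → k ≤ n → 0 < n C k
0<nCk {n}     {zero}  _         = ℕ.z<s
0<nCk {suc n} {suc k} (s≤s k≤n) =
  subst (0 <_) (sym (pascal n k)) (ℕₚ.<-≤-trans (0<nCk k≤n) (ℕₚ.m≤m+n (n C k) (n C suc k)))

absorption : ∀ n k → suc k ℕ.* (suc n C suc k) ≡ suc n ℕ.* (n C k)
absorption zero    zero    = refl
absorption zero    (suc k) = ℕₚ.*-zeroʳ (suc (suc k))
absorption (suc n) zero    =
  trans (ℕₚ.*-identityˡ _) (trans (nC1≡n (suc (suc n))) (sym (ℕₚ.*-identityʳ (suc (suc n)))))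
absorption (suc n) (suc k) = begin
    suc (suc k) ℕ.* (suc (suc n) C suc (suc k))
  ≡⟨ cong (suc (suc k) ℕ.*_) (pascal (suc n) (suc k)) ⟩
    suc (suc k) ℕ.* (suc n C suc k ℕ.+ suc n C suc (suc k))
  ≡⟨ split k (suc n C suc k) (suc n C suc (suc k)) ⟩
    (suc k ℕ.* (suc n C suc k) ℕ.+ suc n C suc k) ℕ.+ suc (suc k) ℕ.* (suc n C suc (suc k))
  ≡⟨ cong₂ (λ u v → (u ℕ.+ suc n C suc k) ℕ.+ v) (absorption n k) (absorption n (suc k)) ⟩
    (suc n ℕ.* (n C k) ℕ.+ suc n C suc k) ℕ.+ suc n ℕ.* (n C suc k)
  ≡⟨ cong (λ x → (suc n ℕ.* (n C k) ℕ.+ x) ℕ.+ suc n ℕ.* (n C suc k)) (pascal n k) ⟩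
    (suc n ℕ.* (n C k) ℕ.+ (n C k ℕ.+ n C suc k)) ℕ.+ suc n ℕ.* (n C suc k)
  ≡⟨ merge n (n C k) (n C suc k) ⟩
    suc (suc n) ℕ.* (n C k ℕ.+ n C suc k)
  ≡⟨ cong (suc (suc n) ℕ.*_) (pascal n k) ⟨
    suc (suc n) ℕ.* (suc n C suc k) ∎
  where
  split : ∀ a x y → suc (suc a) ℕ.* (x ℕ.+ y) ≡ (suc a ℕ.* x ℕ.+ x) ℕ.+ suc (suc a) ℕ.* y
  split = ℕ-Solver.solve-∀
  merge : ∀ a x y → (suc a ℕ.* x ℕ.+ (x ℕ.+ y)) ℕ.+ suc a ℕ.* y ≡ suc (suc a) ℕ.* (x ℕ.+ y)
  merge = ℕ-Solver.solve-∀

subset-of-subset : ∀ a j s → (a C (j ℕ.+ s)) ℕ.* ((j ℕ.+ s) C j) ≡ (a C j) ℕ.* ((a ∸ j) C s)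
subset-of-subset a       zero    s = trans (ℕₚ.*-identityʳ (a C s)) (sym (ℕₚ.+-identityʳ (a C s)))
subset-of-subset zero    (suc j) s = refl
subset-of-subset (suc a) (suc j) s = ℕₚ.*-cancelˡ-≡ _ _ (suc j) (begin
    suc j ℕ.* (X ℕ.* (suc (j ℕ.+ s) C suc j))
  ≡⟨ ℕ*.x∙yz≈y∙xz (suc j) X _ ⟩
    X ℕ.* (suc j ℕ.* (suc (j ℕ.+ s) C suc j))
  ≡⟨ cong (X ℕ.*_) (absorption (j ℕ.+ s) j) ⟩
    X ℕ.* (suc (j ℕ.+ s) ℕ.* Y)
  ≡⟨ ℕ*.x∙yz≈yx∙z X (suc (j ℕ.+ s)) Y ⟩
    suc (j ℕ.+ s) ℕ.* X ℕ.* Y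
  ≡⟨ cong (ℕ._* Y) (absorption a (j ℕ.+ s)) ⟩
    suc a ℕ.* (a C (j ℕ.+ s)) ℕ.* Y
  ≡⟨ ℕₚ.*-assoc (suc a) (a C (j ℕ.+ s)) Y ⟩
    suc a ℕ.* ((a C (j ℕ.+ s)) ℕ.* Y)
  ≡⟨ cong (suc a ℕ.*_) (subset-of-subset a j s) ⟩
    suc a ℕ.* ((a C j) ℕ.* Z)
  ≡⟨ ℕₚ.*-assoc (suc a) (a C j) Z ⟨
    suc a ℕ.* (a C j) ℕ.* Z
  ≡⟨ cong (ℕ._* Z) (absorption a j) ⟨
    suc j ℕ.* (suc a C suc j) ℕ.* Z
  ≡⟨ ℕₚ.*-assoc (suc j) (suc a C suc j) Z ⟩
    suc j ℕ.* ((suc a C suc j) ℕ.* Z) ∎)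
  where
  X Y Z : ℕ
  X = suc a C suc (j ℕ.+ s)
  Y = (j ℕ.+ s) C j
  Z = (a ∸ j) C s

binomialMatrix : ∀ {m} → (Fin m → ℕ) → Matrix m
binomialMatrix x t s = + (x t C toℕ s)

≤-indicator : ℕ → ℕ → ℕ
≤-indicator zero    s       = 1
≤-indicator (suc k) zero    = 0
≤-indicator (suc k) (suc s) = ≤-indicator k s

≤-indicator-< : ∀ {k s} → s < k → ≤-indicator k s ≡ 0
≤-indicator-< {suc k} {zero}  _         = refl
≤-indicator-< {suc k} {suc s} (s≤s s<k) = ≤-indicator-< s<k

≤-indicator-refl : ∀ k → ≤-indicator k k ≡ 1
≤-indicator-refl zero    = refl
≤-indicator-refl (suc k) = ≤-indicator-refl k

≤-indicator-≢ : ∀ k s → s ≢ k → ≤-indicator k s ≡ ≤-indicator (suc k) s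
≤-indicator-≢ zero    zero    s≢k = ⊥-elim (s≢k refl)
≤-indicator-≢ zero    (suc s) _   = refl
≤-indicator-≢ (suc k) zero    _   = refl
≤-indicator-≢ (suc k) (suc s) s≢k = ≤-indicator-≢ k s (s≢k ∘ cong suc)

-- The intermediate matrices of the column reduction from C(x t + 1, s) (stage 0) to C(x t, s) (stage m).
pascalStage : ∀ {m} → (Fin m → ℕ) → ℕ → Matrix m
pascalStage x k t s = + ((≤-indicator k (toℕ s) ℕ.+ x t) C toℕ s)

det-pascalStage-step : ∀ {n} (x : Fin (suc (suc n)) → ℕ) (c : Fin (suc n)) →
  det (pascalStage x (2 ℕ.+ toℕ c)) ≡ det (pascalStage x (1 ℕ.+ toℕ c))
det-pascalStage-step x c = sym (det-add-previous-column c unchanged pascal-column)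
  where
  unchanged : ∀ t s → s ≢ suc c → pascalStage x (2 ℕ.+ toℕ c) t s ≡ pascalStage x (1 ℕ.+ toℕ c) t s
  unchanged t s s≢c+1 = cong (λ e → + ((e ℕ.+ x t) C toℕ s))
    (sym (≤-indicator-≢ (suc (toℕ c)) (toℕ s) (s≢c+1 ∘ Finₚ.toℕ-injective)))
  pascal-column : ∀ t → pascalStage x (1 ℕ.+ toℕ c) t (suc c)
                      ≡ pascalStage x (2 ℕ.+ toℕ c) t (suc c) ℤ.+ pascalStage x (2 ℕ.+ toℕ c) t (inject₁ c)
  pascal-column t = begin
      + ((≤-indicator (toℕ c) (toℕ c) ℕ.+ x t) C suc (toℕ c))
    ≡⟨ cong (λ e → + ((e ℕ.+ x t) C suc (toℕ c))) (≤-indicator-refl (toℕ c)) ⟩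
      + (suc (x t) C suc (toℕ c))
    ≡⟨ cong +_ (trans (pascal (x t) (toℕ c)) (ℕₚ.+-comm (x t C toℕ c) _)) ⟩
      + (x t C suc (toℕ c) ℕ.+ x t C toℕ c)
    ≡⟨ ℤₚ.pos-+ (x t C suc (toℕ c)) (x t C toℕ c) ⟩
      + (x t C suc (toℕ c)) ℤ.+ + (x t C toℕ c)
    ≡⟨ cong₂ (λ e e′ → + ((e ℕ.+ x t) C suc (toℕ c)) ℤ.+ + ((e′ ℕ.+ x t) C toℕ c))
             (sym (≤-indicator-< (ℕₚ.n<1+n (toℕ c))))
             (sym (≤-indicator-< (ℕₚ.m<n⇒m<1+n (ℕₚ.n<1+n (toℕ c))))) ⟩
      + ((≤-indicator (suc (toℕ c)) (toℕ c) ℕ.+ x t) C suc (toℕ c))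
        ℤ.+ + ((≤-indicator (2 ℕ.+ toℕ c) (toℕ c) ℕ.+ x t) C toℕ c)
    ≡⟨ cong (λ i → pascalStage x (2 ℕ.+ toℕ c) t (suc c) ℤ.+ + ((≤-indicator (2 ℕ.+ toℕ c) i ℕ.+ x t) C i))
            (Finₚ.toℕ-inject₁ c) ⟨
      pascalStage x (2 ℕ.+ toℕ c) t (suc c) ℤ.+ pascalStage x (2 ℕ.+ toℕ c) t (inject₁ c) ∎

det-pascalStage : ∀ {m} (x : Fin m → ℕ) k → k ≤ m → det (pascalStage x k) ≡ det (pascalStage x 0)
det-pascalStage x zero          _ = refl
det-pascalStage x (suc zero)    _ = det-cong first-column-constant
  where
  first-column-constant : ∀ t s → pascalStage x 1 t s ≡ pascalStage x 0 t s
  first-column-constant t zero    = refl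
  first-column-constant t (suc s) = refl
det-pascalStage {suc (suc n)} x (suc (suc k)) (s≤s (s≤s k≤n)) = trans
  (subst (λ i → det (pascalStage x (2 ℕ.+ i)) ≡ det (pascalStage x (1 ℕ.+ i)))
         (Finₚ.toℕ-fromℕ< (s≤s k≤n)) (det-pascalStage-step x (fromℕ< (s≤s k≤n))))
  (det-pascalStage x (suc k) (s≤s (ℕₚ.m≤n⇒m≤1+n k≤n)))

det-binomialMatrix-suc : ∀ {m} (x : Fin m → ℕ) → det (binomialMatrix (suc ∘ x)) ≡ det (binomialMatrix x)
det-binomialMatrix-suc {m} x = trans (sym (det-pascalStage x m ℕₚ.≤-refl))
  (det-cong λ t s → cong (λ e → + ((e ℕ.+ x t) C toℕ s)) (≤-indicator-< (Finₚ.toℕ<n s)))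

det-binomialMatrix-+ : ∀ {m} n (x : Fin m → ℕ) → det (binomialMatrix (λ t → n ℕ.+ x t)) ≡ det (binomialMatrix x)
det-binomialMatrix-+ zero    x = refl
det-binomialMatrix-+ (suc n) x = trans (det-binomialMatrix-suc (λ t → n ℕ.+ x t)) (det-binomialMatrix-+ n x)

pos-*-≡ : ∀ a b c d → a ℕ.* b ≡ c ℕ.* d → + a ℤ.* + b ≡ + c ℤ.* + d
pos-*-≡ a b c d ab≡cd = trans (sym (ℤₚ.pos-* a b)) (trans (cong +_ ab≡cd) (ℤₚ.pos-* c d))

prodℤ-suc-toℕ : ∀ m → prodℤ {m} (λ s → + suc (toℕ s)) ≡ + (m !)
prodℤ-suc-toℕ zero    = refl
prodℤ-suc-toℕ (suc m) = begin
    prodℤ {suc m} (λ s → + suc (toℕ s))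
  ≡⟨ prodℤ-init-last {m} (λ s → + suc (toℕ s)) ⟩
    prodℤ {m} (λ s → + suc (toℕ (inject₁ s))) ℤ.* + suc (toℕ (fromℕ m))
  ≡⟨ cong₂ ℤ._*_ (trans (prodℤ-cong {m} λ s → cong (λ i → + suc i) (Finₚ.toℕ-inject₁ s)) (prodℤ-suc-toℕ m))
                 (cong (λ i → + suc i) (Finₚ.toℕ-fromℕ m)) ⟩
    + (m !) ℤ.* + suc m
  ≡⟨ ℤₚ.pos-* (m !) (suc m) ⟨
    + (m ! ℕ.* suc m)
  ≡⟨ cong +_ (ℕₚ.*-comm (m !) (suc m)) ⟩
    + (suc m !) ∎

toℕ-punchIn-fromℕ : ∀ {n} (t : Fin n) → toℕ (punchIn (fromℕ n) t) ≡ toℕ t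
toℕ-punchIn-fromℕ zero    = refl
toℕ-punchIn-fromℕ (suc t) = cong suc (toℕ-punchIn-fromℕ t)

-- Scaling column s by s + 1 and row t by y t + 1 (absorption) leaves the factor m! on the left and
-- (m+1)!/(p+1) on the right, whence the cancellation of (p+1)·m!.
det-binomialMatrix-punchIn-suc : ∀ m (p : Fin (suc m)) →
  det (binomialMatrix (toℕ ∘ punchIn p)) ≡ + (m C toℕ p) →
  det (binomialMatrix (toℕ ∘ punchIn (suc p))) ≡ + (suc m C suc (toℕ p))
det-binomialMatrix-punchIn-suc m p ih =
  ℤₚ.*-cancelˡ-≡ (+ (m !)) X C′ {{m ℕₚ.!≢0}} (ℤₚ.*-cancelˡ-≡ +p _ _ (begin
    +p ℤ.* (+ (m !) ℤ.* X)               ≡⟨ cong (+p ℤ.*_) rescaled ⟩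
    +p ℤ.* (P ℤ.* B)                     ≡⟨ ℤₚ.*-assoc +p P B ⟨
    (+p ℤ.* P) ℤ.* B                     ≡⟨ cong (ℤ._* B) punched-factorial ⟩
    (+ suc m ℤ.* + (m !)) ℤ.* B          ≡⟨ ℤ*.xy∙z≈y∙xz (+ suc m) (+ (m !)) B ⟩
    + (m !) ℤ.* (+ suc m ℤ.* B)          ≡⟨ cong (+ (m !) ℤ.*_) absorbed ⟨
    + (m !) ℤ.* (+p ℤ.* C′)              ≡⟨ ℤ*.x∙yz≈y∙xz (+ (m !)) +p C′ ⟩
    +p ℤ.* (+ (m !) ℤ.* C′)              ∎))
  where
  y : Fin m → ℕ
  y = toℕ ∘ punchIn p
  X : ℤ
  X = det (binomialMatrix (toℕ ∘ punchIn (suc p)))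
  P : ℤ
  P = prodℤ (λ t → + suc (y t))
  +p B C′ : ℤ
  +p = + suc (toℕ p)
  B  = + (m C toℕ p)
  C′ = + (suc m C suc (toℕ p))
  absorbed : +p ℤ.* C′ ≡ + suc m ℤ.* B
  absorbed = pos-*-≡ (suc (toℕ p)) (suc m C suc (toℕ p)) (suc m) (m C toℕ p) (absorption m (toℕ p))
  rescaled : + (m !) ℤ.* X ≡ P ℤ.* B
  rescaled = begin
      + (m !) ℤ.* X
    ≡⟨ cong₂ ℤ._*_ (sym (prodℤ-suc-toℕ m))
                   (det-unit-first-row (binomialMatrix (toℕ ∘ punchIn (suc p))) refl λ _ → refl) ⟩
      prodℤ {m} (λ s → + suc (toℕ s)) ℤ.* det (λ t s → + (suc (y t) C suc (toℕ s)))
    ≡⟨ det-rescale (λ t s → pos-*-≡ (suc (y t) C suc (toℕ s)) (suc (toℕ s)) (suc (y t)) (y t C toℕ s)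
                                    (trans (ℕₚ.*-comm _ (suc (toℕ s))) (absorption (y t) (toℕ s)))) ⟩
      P ℤ.* det (binomialMatrix y)
    ≡⟨ cong (P ℤ.*_) ih ⟩
      P ℤ.* B ∎
  punched-factorial : +p ℤ.* P ≡ + suc m ℤ.* + (m !)
  punched-factorial = begin
      +p ℤ.* P                            ≡⟨ prodℤ-remove {i = p} (λ u → + suc (toℕ u)) ⟨
      prodℤ {suc m} (λ u → + suc (toℕ u)) ≡⟨ prodℤ-suc-toℕ (suc m) ⟩
      + (suc m ℕ.* m !)                   ≡⟨ ℤₚ.pos-* (suc m) (m !) ⟩
      + suc m ℤ.* + (m !)                 ∎

det-binomialMatrix-punchIn : ∀ m (p : Fin (suc m)) → det (binomialMatrix (toℕ ∘ punchIn p)) ≡ + (m C toℕ p)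
det-binomialMatrix-punchIn zero    zero    = refl
det-binomialMatrix-punchIn (suc m) (suc p) =
  det-binomialMatrix-punchIn-suc m p (det-binomialMatrix-punchIn m p)
det-binomialMatrix-punchIn (suc m) zero    = begin
    det (binomialMatrix {suc m} (suc ∘ toℕ))
  ≡⟨ det-binomialMatrix-suc {suc m} toℕ ⟩
    det (binomialMatrix {suc m} toℕ)
  ≡⟨ det-cong {suc m} (λ t s → cong (λ i → + (i C toℕ s)) (toℕ-punchIn-fromℕ t)) ⟨
    det (binomialMatrix {suc m} (toℕ ∘ punchIn (suc (fromℕ m))))
  ≡⟨ det-binomialMatrix-punchIn-suc m (fromℕ m) (det-binomialMatrix-punchIn m (fromℕ m)) ⟩
    + (suc m C suc (toℕ (fromℕ m)))
  ≡⟨ cong (λ i → + (suc m C suc i)) (Finₚ.toℕ-fromℕ m) ⟩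
    + (suc m C suc m)
  ≡⟨ cong +_ (nCn≡1 (suc m)) ⟩
    + 1 ∎

det-punched-binomials : ∀ m (p : Fin (suc m)) {i j} → j ≤ i →
  prodℤ {m} (λ s → + ((j ℕ.+ toℕ s) C j)) ℤ.* det (λ t s → + ((i ℕ.+ toℕ (punchIn p t)) C (j ℕ.+ toℕ s)))
    ≡ prodℤ (λ t → + ((i ℕ.+ toℕ (punchIn p t)) C j)) ℤ.* + (m C toℕ p)
det-punched-binomials m p {i} {j} j≤i = begin
    prodℤ {m} (λ s → + ((j ℕ.+ toℕ s) C j)) ℤ.* det (λ t s → + (x t C (j ℕ.+ toℕ s)))
  ≡⟨ det-rescale (λ t s → pos-*-≡ (x t C (j ℕ.+ toℕ s)) ((j ℕ.+ toℕ s) C j) (x t C j) ((x t ∸ j) C toℕ s)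
                                   (subset-of-subset (x t) j (toℕ s))) ⟩
    P ℤ.* det (binomialMatrix (λ t → x t ∸ j))
  ≡⟨ cong (P ℤ.*_) (det-cong λ t s → cong (λ e → + (e C toℕ s)) (ℕₚ.+-∸-comm (y t) j≤i)) ⟩
    P ℤ.* det (binomialMatrix (λ t → (i ∸ j) ℕ.+ y t))
  ≡⟨ cong (P ℤ.*_) (det-binomialMatrix-+ (i ∸ j) y) ⟩
    P ℤ.* det (binomialMatrix y)
  ≡⟨ cong (P ℤ.*_) (det-binomialMatrix-punchIn m p) ⟩
    P ℤ.* + (m C toℕ p) ∎
  where
  y x : Fin m → ℕ
  y = toℕ ∘ punchIn p
  x t = i ℕ.+ y t
  P : ℤ
  P = prodℤ (λ t → + (x t C j))

lookup-interval : ∀ k n (t : Fin n) → lookup (interval k n) t ≡ k ℕ.+ toℕ t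
lookup-interval k (suc n) zero    = sym (ℕₚ.+-identityʳ k)
lookup-interval k (suc n) (suc t) = trans (lookup-interval (suc k) n t) (sym (ℕₚ.+-suc k (toℕ t)))

lookup-removeAt : ∀ {A : Set} {n} (xs : Vec A (suc n)) (p : Fin (suc n)) (t : Fin n) →
  lookup (removeAt xs p) t ≡ lookup xs (punchIn p t)
lookup-removeAt xs p t = trans (cong (lookup (removeAt xs p)) (sym (Finₚ.punchOut-punchIn p)))
                               (Vecₚ.removeAt-punchOut xs (Finₚ.punchInᵢ≢i p t ∘ sym))

toℕ-pos : ∀ n r (1≤r : 1 ≤ r) (r≤n+1 : r ≤ suc n) → toℕ (pos n r 1≤r r≤n+1) ≡ r ∸ 1
toℕ-pos n r 1≤r r≤n+1 = Finₚ.toℕ-fromℕ< _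

bIJ-lookup : ∀ {m} (I J : Vec ℕ m) {x y : Fin m → ℕ} →
  (∀ t → lookup I t ≡ x t) → (∀ s → lookup J s ≡ y s) → bIJ I J ≡ det (λ t s → + (x t C y s))
bIJ-lookup I J I≗x J≗y = det-cong λ t s → cong₂ (λ e e′ → + (e C e′)) (I≗x t) (J≗y s)

prodℕ-binomials-lookup : ∀ {m} j (v : Vec ℕ m) {x : Fin m → ℕ} →
  (∀ t → lookup v t ≡ x t) → + prodℕ (mapV (λ e → e C j) v) ≡ prodℤ (λ t → + (x t C j))
prodℕ-binomials-lookup j []      v≗x = refl
prodℕ-binomials-lookup j (e ∷ v) v≗x = trans (ℤₚ.pos-* (e C j) (prodℕ (mapV (λ e → e C j) v)))
  (cong₂ ℤ._*_ (cong (λ e → + (e C j)) (v≗x zero)) (prodℕ-binomials-lookup j v (v≗x ∘ suc)))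

0<prodℕ-binomials : ∀ j k n → j ≤ k → 0 < prodℕ (mapV (λ x → x C j) (interval k n))
0<prodℕ-binomials j k zero    _   = ℕ.z<s
0<prodℕ-binomials j k (suc n) j≤k = ℕₚ.*-mono-< (0<nCk j≤k) (0<prodℕ-binomials j (suc k) n (ℕₚ.m≤n⇒m≤1+n j≤k))

theorem6p2 : (d′ i j r : ℕ) → 2 ≤ suc d′ → j ≤ i → (1≤r : 1 ≤ r) → (r≤d : r ≤ suc d′) →
    (bIJ (removeAt (interval i (suc d′)) (pos d′ r 1≤r r≤d)) (interval j d′) / 1)
      ≡ πIJ (removeAt (interval i (suc d′)) (pos d′ r 1≤r r≤d)) (interval j d′)
        * (+ b d′ (r ∸ 1) / 1)
theorem6p2 zero    i j r (s≤s ()) _ _ _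
theorem6p2 (suc n) i j r _ j≤i 1≤r r≤d =
  cross-multiplication (bIJ I′ J) _ _ _ (0<prodℕ-binomials j j (suc n) ℕₚ.≤-refl) (begin
      bIJ I′ J ℤ.* + prodℕ (mapV (λ e → e C j) J)
    ≡⟨ ℤₚ.*-comm (bIJ I′ J) _ ⟩
      + prodℕ (mapV (λ e → e C j) J) ℤ.* bIJ I′ J
    ≡⟨ cong₂ ℤ._*_ (prodℕ-binomials-lookup j J lookup-J) (bIJ-lookup I′ J lookup-I′ lookup-J) ⟩
      prodℤ {suc n} (λ s → + ((j ℕ.+ toℕ s) C j)) ℤ.* det (λ t s → + ((i ℕ.+ toℕ (punchIn p t)) C (j ℕ.+ toℕ s)))
    ≡⟨ det-punched-binomials (suc n) p j≤i ⟩
      prodℤ {suc n} (λ t → + ((i ℕ.+ toℕ (punchIn p t)) C j)) ℤ.* + (suc n C toℕ p)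
    ≡⟨ cong₂ ℤ._*_ (sym (prodℕ-binomials-lookup j I′ lookup-I′))
                   (cong (λ k → + (suc n C k)) (toℕ-pos (suc n) r 1≤r r≤d)) ⟩
      + prodℕ (mapV (λ e → e C j) I′) ℤ.* + (suc n C (r ∸ 1)) ∎)
  where
  p : Fin (suc (suc n))
  p = pos (suc n) r 1≤r r≤d
  I′ J : Vec ℕ (suc n)
  I′ = removeAt (interval i (suc (suc n))) p
  J = interval j (suc n)
  lookup-I′ : ∀ t → lookup I′ t ≡ i ℕ.+ toℕ (punchIn p t)
  lookup-I′ t = trans (lookup-removeAt (interval i (suc (suc n))) p t) (lookup-interval i (suc (suc n)) (punchIn p t))
  lookup-J : ∀ s → lookup J s ≡ j ℕ.+ toℕ s
  lookup-J = lookup-interval j (suc n)
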